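{- Let $\phi$ be an $\mathcal{FL}^3$-sentence in normal form $\forall x_1 x_2 x_3\, \Omega \wedge \bigwedge_{i=1}^{s} \forall x_1 x_2 (\alpha_i \rightarrow \exists x_3\, \Gamma_i) \wedge \bigwedge_{j=1}^{t} \forall x_1 x_2 (\beta_j \rightarrow \forall x_3\, \delta_j)$ over a relational signature $\sigma$. If $\mathfrak{A} \models \phi$ and $b \in A$, then the connector-type $\mathrm{Con}^{\mathfrak{A}}[b]$ is locally compatible with $\phi$.
   Context: $\sigma$ is a purely relational signature without proposition letters (no constants, function symbols or equality). A fluted $k$-atom is $p(x_\ell,\ldots,x_k)$ with $\ell\le k$ and $p\in\sigma$ of arity $k-\ell+1$; fluted $k$-literals are such atoms and their negations; a fluted $k$-clause is a disjunction of fluted $k$-literals. In the normal form, $\Omega,\Gamma_i$ are sets (conjunctions) of fluted 3-clauses, $\alpha_i,\beta_j$ fluted 2-atoms, $\delta_j$ fluted 3-clauses. A fluted $k$-type over $\sigma$ is a maximal consistent set of fluted $k$-literals over $\sigma$ (identified with its conjunction). For a tuple $\bar a$ in $\mathfrak{A}$, $\mathrm{ftp}^{\mathfrak{A}}[\bar a]$ is the unique fluted $k$-type it satisfies, and $\mathrm{tp}^{\mathfrak{A}}[b]$ is the 1-type of $b$. For a $k$-type $\tau$, $\tau^{[1]}$ is obtained by incrementing all variable indices, and (for $k\ge2$) $\tau_\uparrow$ is obtained by removing all literals containing $x_1$ and decrementing variable indices. A connector-type is a triple $\langle \pi, I, O\rangle$ with $\pi$ a 1-type, $I$ a set of fluted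 2-types $\tau$ with $\tau_\uparrow = \pi$, and $O$ a set of fluted 2-types. $\mathrm{Con}^{\mathfrak{A}}[b] = \langle \mathrm{tp}^{\mathfrak{A}}[b], \{\mathrm{ftp}^{\mathfrak{A}}[a,b] : a\in A\}, \{\mathrm{ftp}^{\mathfrak{A}}[b,c] : c \in A\}\rangle$. A connector-type $\langle\pi,I,O\rangle$ is locally compatible with $\phi$ if: (LC$\exists$) for every $i\le s$ and every $\tau\in I$ with $\models \tau\rightarrow\alpha_i$ there is $\tau'\in O$ such that $\tau \wedge \tau'^{[1]} \wedge \Gamma_i \wedge \Omega \wedge \bigwedge_{j=1}^t(\beta_j\rightarrow\delta_j)$ is consistent; and (LC$\forall$) for every $\tau\in I$ and $\tau'\in O$, $\tau \wedge \tau'^{[1]} \wedge \Omega \wedge \bigwedge_{j=1}^t(\beta_j\rightarrow\delta_j)$ is consistent. -}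

module Defs where

open import Data.Nat.Base using (ℕ; zero; suc; _≤_; _≤′_; ≤′-refl; ≤′-step)
open import Data.Fin.Base using (Fin)
open import Data.Bool.Base using (Bool; true; false)
open import Data.Vec.Base using (Vec; []; _∷_)
open import Data.List.Base using (List; [])
open import Data.List.Relation.Unary.Any using (Any)
open import Data.List.Relation.Unary.All using (All)
open import Data.Product using (Σ; Σ-syntax; _×_; _,_; proj₁; proj₂)
open import Relation.Binary.PropositionalEquality using (_≡_; refl)

-- Finite purely relational signature: predicates 0..n-1 with arities
-- (no constants, function symbols, equality, or proposition letters,
--  i.e. every arity is ≥ 1).

record Sig : Set where
  field
    n        : ℕ
    arity    : Fin n → ℕ
    arity≥1  : ∀ p → 1 ≤ arity p

module _ (σ : Sig) where
  open Sig σ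

  -- A fluted k-atom p(x_ℓ,…,x_k): determined by a predicate p whose
  -- arity a satisfies a ≤ k (then ℓ = k - a + 1 ≥ 1).
  Atom : ℕ → Set
  Atom k = Σ[ p ∈ Fin n ] (arity p ≤′ k)

  Literal : ℕ → Set
  Literal k = Atom k × Bool

  Clause : ℕ → Set
  Clause k = List (Literal k)

  -- A fluted k-type: a maximal consistent set of fluted k-literals.
  -- Since all fluted k-atoms are distinct atoms (no equality), such a set
  -- contains, for each fluted k-atom, exactly one of the atom and its
  -- negation; we represent it by the chosen polarity of each atom.
  FlType : ℕ → Set
  FlType k = Atom k → Bool

  -- τ ↦ τ_↑ (for 2-types): drop literals containing x₁ (arity-2 atoms
  -- p(x₁,x₂)), and rename p(x₂) to p(x₁).
  up : FlType 2 → FlType 1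
  up τ (p , le) = τ (p , ≤′-step le)

  -- index shift of a fluted 2-atom: p(x_ℓ,…,x₂) ↦ p(x_{ℓ+1},…,x₃)
  shiftAtom : Atom 2 → Atom 3
  shiftAtom (p , le) = (p , ≤′-step le)

  record Structure : Set₁ where
    field
      A   : Set
      rel : (p : Fin n) → Vec A (arity p) → Bool

  lastN : ∀ {X : Set} {a k} → a ≤′ k → Vec X k → Vec X a
  lastN ≤′-refl      v        = v
  lastN (≤′-step le) (x ∷ v)  = lastN le v

  module _ (𝔄 : Structure) where
    open Structure 𝔄

    evalAtom : ∀ {k} → Atom k → Vec A k → Bool
    evalAtom (p , le) v = rel p (lastN le v)

    LitHolds : ∀ {k} → Literal k → Vec A k → Set
    LitHolds (x , s) v = evalAtom x v ≡ s

    ClauseHolds : ∀ {k} → Clause k → Vec A k → Set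
    ClauseHolds c v = Any (λ l → LitHolds l v) c

    ClausesHold : ∀ {k} → List (Clause k) → Vec A k → Set
    ClausesHold cs v = All (λ c → ClauseHolds c v) cs

    TypeHolds : ∀ {k} → FlType k → Vec A k → Set
    TypeHolds τ v = ∀ x → evalAtom x v ≡ τ x

    ShiftTypeHolds : FlType 2 → Vec A 3 → Set
    ShiftTypeHolds τ v = ∀ x → evalAtom (shiftAtom x) v ≡ τ x

    ftp : ∀ {k} → Vec A k → FlType k
    ftp v x = evalAtom x v

    tp : A → FlType 1
    tp b = ftp (b ∷ [])

  record NormalForm : Set where
    field
      Ω : List (Clause 3)
      s : ℕ
      α : Fin s → Atom 2
      Γ : Fin s → List (Clause 3)
      t : ℕ
      β : Fin t → Atom 2
      δ : Fin t → Clause 3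

  module _ (φ : NormalForm) where
    open NormalForm φ

    _⊨_ : Structure → Set
    _⊨_ 𝔄 =
      (∀ a₁ a₂ a₃ → ClausesHold 𝔄 Ω (a₁ ∷ a₂ ∷ a₃ ∷ [])) ×
      (∀ i a₁ a₂ → evalAtom 𝔄 (α i) (a₁ ∷ a₂ ∷ []) ≡ true →
         Σ[ a₃ ∈ Structure.A 𝔄 ] ClausesHold 𝔄 (Γ i) (a₁ ∷ a₂ ∷ a₃ ∷ [])) ×
      (∀ j a₁ a₂ → evalAtom 𝔄 (β j) (a₁ ∷ a₂ ∷ []) ≡ true →
         ∀ a₃ → ClauseHolds 𝔄 (δ j) (a₁ ∷ a₂ ∷ a₃ ∷ []))

    -- (𝔅,a₁,a₂,a₃) satisfies  τ ∧ τ'^{[1]} ∧ Δ ∧ Ω ∧ ⋀_j (β_j → δ_j)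
    -- (Δ a set of fluted 3-clauses: Γ_i for (LC∃), empty for (LC∀))
    ConjHolds : FlType 2 → FlType 2 → List (Clause 3) →
                (𝔅 : Structure) → (a₁ a₂ a₃ : Structure.A 𝔅) → Set
    ConjHolds τ τ' Δ 𝔅 a₁ a₂ a₃ =
      TypeHolds 𝔅 τ (a₁ ∷ a₂ ∷ []) ×
      ShiftTypeHolds 𝔅 τ' (a₁ ∷ a₂ ∷ a₃ ∷ []) ×
      ClausesHold 𝔅 Δ (a₁ ∷ a₂ ∷ a₃ ∷ []) ×
      ClausesHold 𝔅 Ω (a₁ ∷ a₂ ∷ a₃ ∷ []) ×
      (∀ j → evalAtom 𝔅 (β j) (a₁ ∷ a₂ ∷ []) ≡ true →
         ClauseHolds 𝔅 (δ j) (a₁ ∷ a₂ ∷ a₃ ∷ []))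

    Consistent : FlType 2 → FlType 2 → List (Clause 3) → Set₁
    Consistent τ τ' Δ =
      Σ[ 𝔅 ∈ Structure ] Σ[ a₁ ∈ Structure.A 𝔅 ] Σ[ a₂ ∈ Structure.A 𝔅 ]
        Σ[ a₃ ∈ Structure.A 𝔅 ] ConjHolds τ τ' Δ 𝔅 a₁ a₂ a₃

  Entails : FlType 2 → Atom 2 → Set₁
  Entails τ α = ∀ (𝔅 : Structure) (a₁ a₂ : Structure.A 𝔅) →
    TypeHolds 𝔅 τ (a₁ ∷ a₂ ∷ []) → evalAtom 𝔅 α (a₁ ∷ a₂ ∷ []) ≡ true

  record ConnectorType : Set₁ where
    field
      π    : FlType 1
      I    : FlType 2 → Set
      O    : FlType 2 → Set
      I-up : ∀ τ → I τ → ∀ x → up τ x ≡ π x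

  Con : (𝔄 : Structure) → Structure.A 𝔄 → ConnectorType
  Con 𝔄 b = record
    { π    = tp 𝔄 b
    ; I    = λ τ → Σ[ a ∈ Structure.A 𝔄 ] ftp 𝔄 (a ∷ b ∷ []) ≡ τ
    ; O    = λ τ → Σ[ c ∈ Structure.A 𝔄 ] ftp 𝔄 (b ∷ c ∷ []) ≡ τ
    ; I-up = λ { τ (a , refl) x → refl }
    }

  LocallyCompatible : NormalForm → ConnectorType → Set₁
  LocallyCompatible φ C =
    (∀ (i : Fin s) τ → I τ → Entails τ (α i) →
       Σ[ τ' ∈ FlType 2 ] (O τ' × Consistent φ τ τ' (Γ i))) ×
    (∀ τ τ' → I τ → O τ' → Consistent φ τ τ' [])
    where open NormalForm φ
          open ConnectorType C

module Submission where

-- Both conditions ask for consistency of a conjunction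
--   τ ∧ τ'^{[1]} ∧ Δ ∧ Ω ∧ ⋀_j (β_j → δ_j)
-- where τ ∈ I is the fluted 2-type of some pair (a , b) and τ' ∈ O that of
-- some pair (b , c).  The model 𝔄 itself, with the assignment (a , b , c),
-- witnesses this consistency: the pair types hold by definition, Ω and the
-- universal conjuncts β_j → δ_j hold because 𝔄 ⊨ φ, and Δ holds whenever it
-- holds in 𝔄 at (a , b , c).
-- For (LC∀) take Δ = ∅ and any a, c; for (LC∃) the entailment τ → α_i applied
-- to 𝔄 itself makes α_i true at (a , b), and the existential conjunct of φ
-- supplies the c at which Γ_i holds.

open import Defs
open import Data.Product using (Σ-syntax; _×_; _,_)
open import Data.Vec.Base using (Vec; _∷_; [])
open import Data.List.Base as List using (List)
import Data.List.Relation.Unary.All as All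
open import Relation.Binary.PropositionalEquality using (refl)

module _ (σ : Sig) (𝔄 : Structure σ) where
  open Structure 𝔄

  ftp-holds : ∀ {k} (v : Vec A k) → TypeHolds σ 𝔄 (ftp σ 𝔄 v) v
  ftp-holds v x = refl

  -- (a , b , c) satisfies the shift τ^{[1]} of the fluted type τ of (b , c):
  -- the shifted atom p(x_{ℓ+1},…,x₃) only reads the last entries b , c.
  shifted-ftp-holds : ∀ a b c →
    ShiftTypeHolds σ 𝔄 (ftp σ 𝔄 (b ∷ c ∷ [])) (a ∷ b ∷ c ∷ [])
  shifted-ftp-holds a b c x = refl

  actual-triple-consistent : (φ : NormalForm σ) → _⊨_ σ φ 𝔄 →
    ∀ a b c (Δ : List (Clause σ 3)) →
    ClausesHold σ 𝔄 Δ (a ∷ b ∷ c ∷ []) →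
    Consistent σ φ (ftp σ 𝔄 (a ∷ b ∷ [])) (ftp σ 𝔄 (b ∷ c ∷ [])) Δ
  actual-triple-consistent φ (models-Ω , _ , models-β) a b c Δ Δ-holds =
    𝔄 , a , b , c ,
    ftp-holds (a ∷ b ∷ []) , shifted-ftp-holds a b c , Δ-holds ,
    models-Ω a b c , (λ j β-true → models-β j a b β-true c)

lemma2 : (σ : Sig) (φ : NormalForm σ) (𝔄 : Structure σ) →
         _⊨_ σ φ 𝔄 → (b : Structure.A 𝔄) →
         LocallyCompatible σ φ (Con σ 𝔄 b)
lemma2 σ φ 𝔄 models@(_ , models-α , _) b = LC∃ , LC∀
  where
  open NormalForm φ

  -- τ → α_i evaluated in 𝔄 makes α_i true at (a , b); the existential
  -- witness c for Γ_i then gives τ' = ftp[b , c] ∈ O.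
  LC∃ : ∀ i τ → ConnectorType.I (Con σ 𝔄 b) τ → Entails σ τ (α i) →
        Σ[ τ' ∈ FlType σ 2 ]
          (ConnectorType.O (Con σ 𝔄 b) τ' × Consistent σ φ τ τ' (Γ i))
  LC∃ i τ (a , refl) τ⇒α
    with models-α i a b (τ⇒α 𝔄 a b (ftp-holds σ 𝔄 (a ∷ b ∷ [])))
  ... | c , Γ-holds =
    ftp σ 𝔄 (b ∷ c ∷ []) , (c , refl) ,
    actual-triple-consistent σ 𝔄 φ models a b c (Γ i) Γ-holds

  LC∀ : ∀ τ τ' → ConnectorType.I (Con σ 𝔄 b) τ →
        ConnectorType.O (Con σ 𝔄 b) τ' →
        Consistent σ φ τ τ' List.[]
  LC∀ τ τ' (a , refl) (c , refl) =
    actual-triple-consistent σ 𝔄 φ models a b c List.[] All.[]
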